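{- Let $u\equiv 0\pmod 3$, $u\geq 12$. Then the graph $\langle \mathbb Z_u\cup\{\infty_1,\infty_2,\dots,\infty_8\},\{1,\frac u3\}\rangle$ can be decomposed into $3$-suns.
   Context: A $3$-sun is the graph on six vertices $a,b,c,d,e,f$ with edges $\{a,b\},\{b,c\},\{c,a\},\{a,d\},\{b,e\},\{c,f\}$; a decomposition of a graph into $3$-suns is a partition of its edge set into subgraphs isomorphic to a $3$-sun. For a positive integer $u$, $\mathbb Z_u=\{0,1,\dots,u-1\}$ (integers mod $u$), and for distinct $i,j\in\mathbb Z_u$, $|i-j|_u=\min\{|i-j|,u-|i-j|\}$. For a set $H$ disjoint from $\mathbb Z_u$ and a nonempty set $D\subseteq\{1,\dots,\lfloor u/2\rfloor\}$, $\langle \mathbb Z_u\cup H,D\rangle$ is the graph with vertex set $\mathbb Z_u\cup H$ and edge set $\{\{i,j\}: i,j\in\mathbb Z_u,\ |i-j|_u\in D\}\cup\{\{\infty,i\}:\infty\in H,\ i\in\mathbb Z_u\}$. -}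

module Defs where

open import Data.Nat using (ℕ; _⊓_; _∸_; ∣_-_∣; _≤_; _/_)
open import Data.Fin as Fin using (Fin; toℕ)
open import Data.Fin.Properties using () renaming (_≟_ to _≟F_)
open import Data.Sum using (_⊎_; inj₁; inj₂)
open import Data.Sum.Properties using (≡-dec)
open import Data.Product using (_×_; _,_; Σ)
open import Data.List using (List; []; _∷_; length; filter; concatMap)
open import Data.List.Membership.Propositional using (_∈_)
open import Data.List.Relation.Unary.All using (All)
open import Data.List.Relation.Unary.Unique.Propositional using (Unique)
open import Data.Unit using (⊤)
open import Data.Empty using (⊥)
open import Relation.Binary.PropositionalEquality using (_≡_)
open import Relation.Binary.Definitions using (DecidableEquality)
open import Relation.Nullary using (Dec; _⊎-dec_; _×-dec_)

-- Vertex set Z_u ∪ H, with H = {∞_1,…,∞_h} represented by Fin h.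
Vertex : ℕ → ℕ → Set
Vertex u h = Fin u ⊎ Fin h

_≟V_ : ∀ {u h} → DecidableEquality (Vertex u h)
_≟V_ = ≡-dec _≟F_ _≟F_

cdist : ∀ {u} → Fin u → Fin u → ℕ
cdist {u} i j = ∣ toℕ i - toℕ j ∣ ⊓ (u ∸ ∣ toℕ i - toℕ j ∣)

-- Adjacency of the graph ⟨Z_u ∪ H, D⟩ (D given as a list of differences,
-- assumed ⊆ {1,…,⌊u/2⌋}).
Adj : ∀ {u h} → List ℕ → Vertex u h → Vertex u h → Set
Adj D (inj₁ i) (inj₁ j) = cdist i j ∈ D
Adj D (inj₁ i) (inj₂ _) = ⊤
Adj D (inj₂ _) (inj₁ j) = ⊤
Adj D (inj₂ _) (inj₂ _) = ⊥

record Sun (V : Set) : Set where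
  field
    a b c d e f : V
    distinct : Unique (a ∷ b ∷ c ∷ d ∷ e ∷ f ∷ [])

sunEdges : ∀ {V} → Sun V → List (V × V)
sunEdges s = (a , b) ∷ (b , c) ∷ (c , a) ∷ (a , d) ∷ (b , e) ∷ (c , f) ∷ []
  where open Sun s

SameEdge : ∀ {V : Set} → V × V → V × V → Set
SameEdge (x , y) (x' , y') = ((x ≡ x') × (y ≡ y')) ⊎ ((x ≡ y') × (y ≡ x'))

sameEdge? : ∀ {u h} (e e' : Vertex u h × Vertex u h) → Dec (SameEdge e e')
sameEdge? (x , y) (x' , y') =
  ((x ≟V x') ×-dec (y ≟V y')) ⊎-dec ((x ≟V y') ×-dec (y ≟V x'))

count : ∀ {u h} → Vertex u h × Vertex u h → List (Vertex u h × Vertex u h) → ℕ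
count e L = length (filter (sameEdge? e) L)

IsSunDecomposition : ∀ {u h} → List ℕ → List (Sun (Vertex u h)) → Set
IsSunDecomposition {u} {h} D S =
  All (λ { (x , y) → Adj D x y }) (concatMap sunEdges S)
  × (∀ (x y : Vertex u h) → Adj D x y → count (x , y) (concatMap sunEdges S) ≡ 1)

SunDecomposable : ℕ → ℕ → List ℕ → Set
SunDecomposable u h D = Σ (List (Sun (Vertex u h))) (IsSunDecomposition D)

module Submission where

-- Write ℤ_{3k} as three rows of length k, x = k t + r, and label each edge of the graph by
-- its lower end: {x, x+1} by (step , x), {x, x+k} by (jump , x), {∞_a, x} by (spoke a , x).
-- A list of suns is a decomposition as soon as its edges carry every label exactly once.
-- Both differences respect the grid (1 moves along a row, from the end of a row to the start
-- of the next; k moves to the next row), so the labels whose lower end lies in columns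
-- [o, o+w) are covered by one fixed pattern of 5w suns shifted to column o.  The pattern only
-- has to stay a genuine sun when its column w is read as the first column of the next block
-- or, if the block ends the rows, as column 0 of the next row.  Patterns of widths 3 and 5
-- exist (checked by evaluation); they tile k = 5, 6 and every k ≥ 8, and for k = 4 and
-- k = 7 explicit decompositions are checked.

open import Defs

open import Data.Empty using (⊥; ⊥-elim)
open import Data.Fin as Fin using (Fin; toℕ; combine; remQuot; quotient; remainder)
open import Data.Fin.Patterns using (0F; 1F; 2F; 3F; 4F; 5F; 6F; 7F)
open import Data.Fin.Properties
  using (toℕ-fromℕ<; toℕ-injective; toℕ<n; toℕ-combine; combine-remQuot; remQuot-combine)
  renaming (all? to ∀-fin?)
open import Data.List using (List; []; _∷_; _++_; length; filter; map; concatMap)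
open import Data.List.Membership.Propositional using (_∈_)
open import Data.List.Properties
  using (filter-accept; filter-reject; filter-++; length-++; map-++; concatMap-++)
open import Data.List.Relation.Binary.Pointwise as Pointwise using (Pointwise; []; _∷_)
open import Data.List.Relation.Unary.All using (All; []; _∷_; all?)
open import Data.List.Relation.Unary.AllPairs as AllPairs using (AllPairs; allPairs?)
import Data.List.Relation.Unary.AllPairs.Properties as AllPairs
open import Data.List.Relation.Unary.Any using (here; there)
open import Data.Maybe using (Maybe; just; nothing; _>>=_; from-just)
open import Data.Nat as ℕ
  using (ℕ; zero; suc; _+_; _*_; _∸_; _≤_; _<_; _⊓_; ∣_-_∣; z≤n; s≤s; z<s; NonZero; >-nonZero⁻¹; _%_; _/_)
open import Data.Nat.Divisibility using (_∣_; divides)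
open import Data.Nat.DivMod
open import Data.Nat.Properties
open import Data.Nat.Tactic.RingSolver using (solve-∀)
open import Data.Product using (Σ; _×_; _,_; proj₁; proj₂)
open import Data.Product.Properties using (≡-dec)
open import Data.Sum as Sum using (_⊎_; inj₁; inj₂; swap; [_,_]′)
open import Data.Sum.Properties using (inj₁-injective; inj₂-injective)
open import Data.Unit using (⊤; tt)
open import Function using (_∘_)
open import Relation.Binary.Definitions using (DecidableEquality)
open import Relation.Binary.PropositionalEquality hiding ([_])
open import Relation.Nullary using (¬_; Dec; yes; no; ¬?; _×-dec_)
open import Relation.Nullary.Decidable using (dec⇒maybe)

cdist-comm : ∀ {u} (x y : Fin u) → cdist x y ≡ cdist y x
cdist-comm x y rewrite ∣-∣-comm (toℕ x) (toℕ y) = refl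

module Cyclic (N : ℕ) .{{_ : NonZero N}} where

  [_] : ℕ → Fin N
  [ n ] = n mod N

  _⊕_ : Fin N → ℕ → Fin N
  x ⊕ a = [ toℕ x + a ]

  toℕ-[] : ∀ n → toℕ [ n ] ≡ n % N
  toℕ-[] n = toℕ-fromℕ< (m%n<n n N)

  []-cong-% : ∀ {m n} → m % N ≡ n % N → [ m ] ≡ [ n ]
  []-cong-% {m} {n} eq = toℕ-injective (trans (toℕ-[] m) (trans eq (sym (toℕ-[] n))))

  []-toℕ : ∀ x → [ toℕ x ] ≡ x
  []-toℕ x = toℕ-injective (trans (toℕ-[] (toℕ x)) (m<n⇒m%n≡m (toℕ<n x)))

  []-+N : ∀ n → [ n + N ] ≡ [ n ]
  []-+N n = []-cong-% ([m+n]%n≡m%n n N)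

  []-⊕ : ∀ n a → [ n ] ⊕ a ≡ [ n + a ]
  []-⊕ n a = []-cong-% (begin
    (toℕ [ n ] + a) % N     ≡⟨ cong (λ m → (m + a) % N) (toℕ-[] n) ⟩
    (n % N + a) % N         ≡⟨ %-distribˡ-+ (n % N) a N ⟩
    (n % N % N + a % N) % N ≡⟨ cong (λ m → (m + a % N) % N) (m%n%n≡m%n n N) ⟩
    (n % N + a % N) % N     ≡⟨ %-distribˡ-+ n a N ⟨
    (n + a) % N             ∎)
    where open ≡-Reasoning

  ⊕-assoc : ∀ x a b → (x ⊕ a) ⊕ b ≡ x ⊕ (a + b)
  ⊕-assoc x a b = trans ([]-⊕ (toℕ x + a) b) (cong [_] (+-assoc (toℕ x) a b))

  private
    %-wrap : ∀ {m} → N ≤ m → m < N + N → m % N ≡ m ∸ N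
    %-wrap {m} N≤m m<2N =
      trans (sym (m≤n⇒[n∸m]%m≡n%m N≤m)) (m<n⇒m%n≡m (subst (m ∸ N <_) (m+n∸m≡n N N) (∸-monoˡ-< m<2N N≤m)))

  ⊕-≢ : ∀ x {c} → 0 < c → c < N → x ⊕ c ≢ x
  ⊕-≢ x {c} 0<c c<N x⊕c≡x = helper (toℕ x + c <? N)
    where
    open ≡-Reasoning
    a : ℕ
    a = toℕ x
    wraps-to-a : (a + c) % N ≡ a
    wraps-to-a = trans (sym (toℕ-[] (a + c))) (cong toℕ x⊕c≡x)
    helper : Dec (a + c < N) → ⊥
    helper (yes a+c<N) = <⇒≢ 0<c (sym (+-cancelˡ-≡ a c 0 (begin
      a + c       ≡⟨ sym (m<n⇒m%n≡m a+c<N) ⟩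
      (a + c) % N ≡⟨ wraps-to-a ⟩
      a           ≡⟨ sym (+-identityʳ a) ⟩
      a + 0       ∎)))
    helper (no a+c≮N) = <⇒≢ c<N (+-cancelˡ-≡ a c N (begin
      a + c           ≡⟨ sym (m∸n+n≡m N≤a+c) ⟩
      (a + c ∸ N) + N ≡⟨ cong (_+ N) (sym (%-wrap N≤a+c (+-mono-< (toℕ<n x) c<N))) ⟩
      (a + c) % N + N ≡⟨ cong (_+ N) wraps-to-a ⟩
      a + N           ∎))
      where
      N≤a+c : N ≤ a + c
      N≤a+c = ≮⇒≥ a+c≮N

  private
    ⊓-complement-flip : ∀ {d} → d ≤ N → (N ∸ d) ⊓ (N ∸ (N ∸ d)) ≡ d ⊓ (N ∸ d)
    ⊓-complement-flip {d} d≤N = trans (cong ((N ∸ d) ⊓_) (m∸[m∸n]≡n d≤N)) (⊓-comm (N ∸ d) d)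

    ⊓-complement-small : ∀ {c} → c + c ≤ N → c ⊓ (N ∸ c) ≡ c
    ⊓-complement-small {c} c+c≤N = m≤n⇒m⊓n≡m (subst (_≤ N ∸ c) (m+n∸m≡n c c) (∸-monoˡ-≤ c c+c≤N))

  cdist-⊕ : ∀ x {c} → c + c ≤ N → cdist x (x ⊕ c) ≡ c
  cdist-⊕ x {c} c+c≤N with toℕ x + c <? N
  ... | yes a+c<N = begin
    cdist x (x ⊕ c)
      ≡⟨ cong (λ b → ∣ a - b ∣ ⊓ (N ∸ ∣ a - b ∣)) (trans (toℕ-[] (a + c)) (m<n⇒m%n≡m a+c<N)) ⟩
    ∣ a - a + c ∣ ⊓ (N ∸ ∣ a - a + c ∣) ≡⟨ cong (λ d → d ⊓ (N ∸ d)) (∣m-m+n∣≡n a c) ⟩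
    c ⊓ (N ∸ c)                         ≡⟨ ⊓-complement-small c+c≤N ⟩
    c                                   ∎
    where
    open ≡-Reasoning
    a : ℕ
    a = toℕ x
  ... | no a+c≮N = begin
    cdist x (x ⊕ c)
      ≡⟨ cong (λ b → ∣ a - b ∣ ⊓ (N ∸ ∣ a - b ∣)) (trans (toℕ-[] (a + c)) (%-wrap N≤a+c (+-mono-<-≤ (toℕ<n x) c≤N))) ⟩
    ∣ a - b ∣ ⊓ (N ∸ ∣ a - b ∣)           ≡⟨ cong (λ d → d ⊓ (N ∸ d)) ∣a-b∣≡N∸c ⟩
    (N ∸ c) ⊓ (N ∸ (N ∸ c))               ≡⟨ ⊓-complement-flip c≤N ⟩
    c ⊓ (N ∸ c)                           ≡⟨ ⊓-complement-small c+c≤N ⟩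
    c                                     ∎
    where
    open ≡-Reasoning
    a b : ℕ
    a = toℕ x
    b = a + c ∸ N
    N≤a+c : N ≤ a + c
    N≤a+c = ≮⇒≥ a+c≮N
    c≤N : c ≤ N
    c≤N = ≤-trans (m≤m+n c c) c+c≤N
    b+[N∸c]≡a : b + (N ∸ c) ≡ a
    b+[N∸c]≡a = begin
      b + (N ∸ c) ≡⟨ sym (+-∸-assoc b c≤N) ⟩
      b + N ∸ c   ≡⟨ cong (_∸ c) (m∸n+n≡m N≤a+c) ⟩
      a + c ∸ c   ≡⟨ m+n∸n≡m a c ⟩
      a           ∎
    ∣a-b∣≡N∸c : ∣ a - b ∣ ≡ N ∸ c
    ∣a-b∣≡N∸c = begin
      ∣ a - b ∣             ≡⟨ cong ∣_- b ∣ b+[N∸c]≡a ⟨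
      ∣ b + (N ∸ c) - b ∣   ≡⟨ ∣-∣-comm (b + (N ∸ c)) b ⟩
      ∣ b - b + (N ∸ c) ∣   ≡⟨ ∣m-m+n∣≡n b (N ∸ c) ⟩
      N ∸ c                 ∎

  private
    cdist≡⇒⊕-ordered : ∀ x y {c} → toℕ x ≤ toℕ y → cdist x y ≡ c → y ≡ x ⊕ c ⊎ x ≡ y ⊕ c
    cdist≡⇒⊕-ordered x y {c} x≤y eq = helper (⊓-sel d (N ∸ d))
      where
      open ≡-Reasoning
      a b d : ℕ
      a = toℕ x
      b = toℕ y
      d = b ∸ a
      a+d≡b : a + d ≡ b
      a+d≡b = m+[n∸m]≡n x≤y
      d≤N : d ≤ N
      d≤N = ≤-trans (m∸n≤m b a) (<⇒≤ (toℕ<n y))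
      d⊓[N∸d]≡c : d ⊓ (N ∸ d) ≡ c
      d⊓[N∸d]≡c = trans (cong (λ e → e ⊓ (N ∸ e)) (sym (m≤n⇒∣m-n∣≡n∸m x≤y))) eq
      helper : d ⊓ (N ∸ d) ≡ d ⊎ d ⊓ (N ∸ d) ≡ N ∸ d → y ≡ x ⊕ c ⊎ x ≡ y ⊕ c
      helper (inj₁ short) = inj₁ (begin
        y         ≡⟨ []-toℕ y ⟨
        [ b ]     ≡⟨ cong [_] a+d≡b ⟨
        [ a + d ] ≡⟨ cong (λ e → [ a + e ]) (trans (sym short) d⊓[N∸d]≡c) ⟩
        x ⊕ c     ∎)
      helper (inj₂ long) = inj₂ (begin
        x                     ≡⟨ []-toℕ x ⟨
        [ a ]                 ≡⟨ []-+N a ⟨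
        [ a + N ]             ≡⟨ cong (λ e → [ a + e ]) (m+[n∸m]≡n d≤N) ⟨
        [ a + (d + (N ∸ d)) ] ≡⟨ cong [_] (+-assoc a d (N ∸ d)) ⟨
        [ a + d + (N ∸ d) ]   ≡⟨ cong (λ e → [ e + (N ∸ d) ]) a+d≡b ⟩
        [ b + (N ∸ d) ]       ≡⟨ cong (λ e → [ b + e ]) (trans (sym long) d⊓[N∸d]≡c) ⟩
        y ⊕ c                 ∎)

  cdist≡⇒⊕ : ∀ x y {c} → cdist x y ≡ c → y ≡ x ⊕ c ⊎ x ≡ y ⊕ c
  cdist≡⇒⊕ x y eq with ≤-total (toℕ x) (toℕ y)
  ... | inj₁ x≤y = cdist≡⇒⊕-ordered x y x≤y eq
  ... | inj₂ y≤x = swap (cdist≡⇒⊕-ordered y x y≤x (trans (cdist-comm y x) eq))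

SameEdge-sym : ∀ {V : Set} {e e′ : V × V} → SameEdge e e′ → SameEdge e′ e
SameEdge-sym (inj₁ (refl , refl)) = inj₁ (refl , refl)
SameEdge-sym (inj₂ (refl , refl)) = inj₂ (refl , refl)

SameEdge-trans : ∀ {V : Set} {e e′ e″ : V × V} → SameEdge e e′ → SameEdge e′ e″ → SameEdge e e″
SameEdge-trans (inj₁ (refl , refl)) s = s
SameEdge-trans (inj₂ (refl , refl)) (inj₁ (refl , refl)) = inj₂ (refl , refl)
SameEdge-trans (inj₂ (refl , refl)) (inj₂ (refl , refl)) = inj₁ (refl , refl)

Adj-sym : ∀ {u h} (D : List ℕ) (x y : Vertex u h) → Adj D x y → Adj D y x
Adj-sym D (inj₁ i) (inj₁ j) i~j = subst (_∈ D) (cdist-comm i j) i~j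
Adj-sym D (inj₁ i) (inj₂ a) _ = tt
Adj-sym D (inj₂ a) (inj₁ j) _ = tt

module _ {A : Set} (_≟_ : DecidableEquality A) where

  occurrences : A → List A → ℕ
  occurrences x xs = length (filter (_≟ x) xs)

  occurrences-++ : ∀ x xs ys → occurrences x (xs ++ ys) ≡ occurrences x xs + occurrences x ys
  occurrences-++ x xs ys = trans (cong length (filter-++ (_≟ x) xs ys)) (length-++ (filter (_≟ x) xs))

module _ {A B : Set} (_≟ᴬ_ : DecidableEquality A) (_≟ᴮ_ : DecidableEquality B) (f : A → B) {P : A → Set} where

  occurrences-map : ∀ {x y} → f x ≡ y → (∀ {a} → P a → f a ≡ y → a ≡ x) →
                    ∀ {as} → All P as → occurrences _≟ᴮ_ y (map f as) ≡ occurrences _≟ᴬ_ x as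
  occurrences-map fx≡y fa≡y⇒a≡x [] = refl
  occurrences-map {x} {y} fx≡y fa≡y⇒a≡x {a ∷ as} (pa ∷ pas) with a ≟ᴬ x
  ... | yes refl = trans (cong length (filter-accept (_≟ᴮ y) fx≡y)) (cong suc (occurrences-map fx≡y fa≡y⇒a≡x pas))
  ... | no a≢x   = trans (cong length (filter-reject (_≟ᴮ y) (λ fa≡y → a≢x (fa≡y⇒a≡x pa fa≡y))))
                         (occurrences-map fx≡y fa≡y⇒a≡x pas)

  occurrences-map-∉ : ∀ {y} → (∀ {a} → P a → f a ≢ y) →
                      ∀ {as} → All P as → occurrences _≟ᴮ_ y (map f as) ≡ 0
  occurrences-map-∉ fa≢y [] = refl
  occurrences-map-∉ {y} fa≢y (pa ∷ pas) =
    trans (cong length (filter-reject (_≟ᴮ y) (fa≢y pa))) (occurrences-map-∉ fa≢y pas)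

data EdgeKind : Set where
  step jump : EdgeKind
  spoke : Fin 8 → EdgeKind

_≟ᴷ_ : DecidableEquality EdgeKind
step    ≟ᴷ step    = yes refl
jump    ≟ᴷ jump    = yes refl
spoke a ≟ᴷ spoke b with a Fin.≟ b
... | yes refl = yes refl
... | no a≢b   = no λ { refl → a≢b refl }
step    ≟ᴷ jump    = no λ ()
step    ≟ᴷ spoke _ = no λ ()
jump    ≟ᴷ step    = no λ ()
jump    ≟ᴷ spoke _ = no λ ()
spoke _ ≟ᴷ step    = no λ ()
spoke _ ≟ᴷ jump    = no λ ()

next : Fin 3 → Fin 3
next 0F = 1F
next 1F = 2F
next 2F = 0F

next-injective : ∀ {s t} → next s ≡ next t → s ≡ t
next-injective {0F} {0F} _ = refl
next-injective {1F} {1F} _ = refl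
next-injective {2F} {2F} _ = refl
next-injective {0F} {1F} ()
next-injective {0F} {2F} ()
next-injective {1F} {0F} ()
next-injective {1F} {2F} ()
next-injective {2F} {0F} ()
next-injective {2F} {1F} ()

-- Placed at column o, cell t d becomes the vertex k t + (o + d) of ℤ_{3k} (see place below).
data Point : Set where
  cell : Fin 3 → ℕ → Point
  ∞    : Fin 8 → Point

record Pattern : Set where
  constructor sun
  field a b c d e f : Point

points : Pattern → List Point
points (sun a b c d e f) = a ∷ b ∷ c ∷ d ∷ e ∷ f ∷ []

patternEdges : Pattern → List (Point × Point)
patternEdges (sun a b c d e f) = (a , b) ∷ (b , c) ∷ (c , a) ∷ (a , d) ∷ (b , e) ∷ (c , f) ∷ []

CellLabel : Set
CellLabel = EdgeKind × Fin 3 × ℕ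

_≟ᶜ_ : DecidableEquality CellLabel
_≟ᶜ_ = ≡-dec _≟ᴷ_ (≡-dec Fin._≟_ ℕ._≟_)

column : CellLabel → ℕ
column (_ , _ , d) = d

data Carries : Point × Point → CellLabel → Set where
  step   : ∀ t d → Carries (cell t d , cell t (suc d)) (step , t , d)
  step⁻  : ∀ t d → Carries (cell t (suc d) , cell t d) (step , t , d)
  jump   : ∀ t d → Carries (cell t d , cell (next t) d) (jump , t , d)
  jump⁻  : ∀ t d → Carries (cell (next t) d , cell t d) (jump , t , d)
  spoke  : ∀ a t d → Carries (∞ a , cell t d) (spoke a , t , d)
  spoke⁻ : ∀ a t d → Carries (cell t d , ∞ a) (spoke a , t , d)

private
  step? : ∀ t d d′ → Maybe (Σ CellLabel (Carries (cell t d , cell t d′)))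
  step? t d d′ with d′ ℕ.≟ suc d | d ℕ.≟ suc d′
  ... | yes refl | _        = just (_ , step t d)
  ... | _        | yes refl = just (_ , step⁻ t d′)
  ... | _        | _        = nothing

  jump? : ∀ t t′ d d′ → Maybe (Σ CellLabel (Carries (cell t d , cell t′ d′)))
  jump? t t′ d d′ with d ℕ.≟ d′ | t′ Fin.≟ next t | t Fin.≟ next t′
  ... | yes refl | yes refl | _        = just (_ , jump t d)
  ... | yes refl | _        | yes refl = just (_ , jump⁻ t′ d)
  ... | _        | _        | _        = nothing

carried? : (ε : Point × Point) → Maybe (Σ CellLabel (Carries ε))
carried? (∞ a , cell t d) = just (_ , spoke a t d)
carried? (cell t d , ∞ a) = just (_ , spoke⁻ a t d)
carried? (∞ _ , ∞ _)      = nothing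
carried? (cell t d , cell t′ d′) with t Fin.≟ t′
... | yes refl = step? t d d′
... | no _     = jump? t t′ d d′

labelling? : (εs : List (Point × Point)) → Maybe (Σ (List CellLabel) (Pointwise Carries εs))
labelling? [] = just ([] , [])
labelling? (ε ∷ εs) = do
  (α , ε↦α) ← carried? ε
  (αs , εs↦αs) ← labelling? εs
  just (α ∷ αs , ε↦α ∷ εs↦αs)

Wraps : ℕ → Fin 3 × ℕ → Fin 3 × ℕ → Set
Wraps w (t , d) (t′ , d′) = d ≡ w × d′ ≡ 0 × t′ ≡ next t

-- Column w of a block is column 0 of the next row when the block ends the rows, and the
-- first column of the next block otherwise: the points of a sun must be apart in both readings.
Apart : ℕ → Point → Point → Set
Apart w (cell t d) (cell t′ d′) =
  d ≤ w × d′ ≤ w × (t , d) ≢ (t′ , d′) × ¬ Wraps w (t , d) (t′ , d′) × ¬ Wraps w (t′ , d′) (t , d)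
Apart w (cell _ _) (∞ _) = ⊤
Apart w (∞ _) (cell _ _) = ⊤
Apart w (∞ a) (∞ b) = a ≢ b

apart? : ∀ w p q → Dec (Apart w p q)
apart? w (cell t d) (cell t′ d′) =
  d ℕ.≤? w ×-dec d′ ℕ.≤? w ×-dec ¬? (≡-dec Fin._≟_ ℕ._≟_ (t , d) (t′ , d′))
    ×-dec ¬? (wraps? (t , d) (t′ , d′)) ×-dec ¬? (wraps? (t′ , d′) (t , d))
  where
  wraps? : ∀ p q → Dec (Wraps w p q)
  wraps? (t , d) (t′ , d′) = d ℕ.≟ w ×-dec d′ ℕ.≟ 0 ×-dec t′ Fin.≟ next t
apart? w (cell _ _) (∞ _) = yes tt
apart? w (∞ _) (cell _ _) = yes tt
apart? w (∞ a) (∞ b) = ¬? (a Fin.≟ b)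

∀-kind? : {P : EdgeKind → Set} → (∀ κ → Dec (P κ)) → Dec (∀ κ → P κ)
∀-kind? P? with P? step | P? jump | ∀-fin? (λ a → P? (spoke a))
... | yes p | yes q | yes r = yes λ { step → p ; jump → q ; (spoke a) → r a }
... | no ¬p | _     | _     = no λ ∀P → ¬p (∀P step)
... | _     | no ¬q | _     = no λ ∀P → ¬q (∀P jump)
... | _     | _     | no ¬r = no λ ∀P → ¬r (λ a → ∀P (spoke a))

record Block (w : ℕ) : Set where
  field
    suns      : List Pattern
    labels    : List CellLabel
    carries   : Pointwise Carries (concatMap patternEdges suns) labels
    in-block  : All (λ α → column α < w) labels
    separated : All (λ s → AllPairs (Apart w) (points s)) suns
    exact     : ∀ κ t (d : Fin w) → occurrences _≟ᶜ_ (κ , t , toℕ d) labels ≡ 1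

block? : ∀ w → List Pattern → Maybe (Block w)
block? w P = do
  (αs , carries) ← labelling? (concatMap patternEdges P)
  in-block ← dec⇒maybe (all? (λ α → column α <? w) αs)
  separated ← dec⇒maybe (all? (λ s → allPairs? (apart? w) (points s)) P)
  exact ← dec⇒maybe (∀-kind? λ κ → ∀-fin? λ t → ∀-fin? λ d →
                      occurrences _≟ᶜ_ (κ , t , toℕ d) αs ℕ.≟ 1)
  just record { suns = P ; labels = αs ; carries = carries
              ; in-block = in-block ; separated = separated ; exact = exact }

data Tiling : ℕ → Set where
  []  : Tiling 0
  _∷_ : ∀ {w n} → Block w → Tiling n → Tiling (w + n)

private
  m*[1+n]+o≡m*n+o+m : ∀ m n o → m * suc n + o ≡ m * n + o + m
  m*[1+n]+o≡m*n+o+m = solve-∀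

  m*0+n+3*m≡m*2+n+m : ∀ m n → m * 0 + n + 3 * m ≡ m * 2 + n + m
  m*0+n+3*m≡m*2+n+m = solve-∀

module Construction (k : ℕ) .{{_ : NonZero k}} where

  N : ℕ
  N = 3 * k

  instance
    N-nonZero : NonZero N
    N-nonZero = m*n≢0 3 k

  open Cyclic N public

  V : Set
  V = Vertex N 8

  Δ : List ℕ
  Δ = 1 ∷ k ∷ []

  Label : Set
  Label = EdgeKind × Fin N

  _≟ᴸ_ : DecidableEquality Label
  _≟ᴸ_ = ≡-dec _≟ᴷ_ Fin._≟_

  countᴸ : Label → List Label → ℕ
  countᴸ = occurrences _≟ᴸ_

  edgeOf : Label → V × V
  edgeOf (step , x) = inj₁ x , inj₁ (x ⊕ 1)
  edgeOf (jump , x) = inj₁ x , inj₁ (x ⊕ k)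
  edgeOf (spoke a , x) = inj₂ a , inj₁ x

  k+k<N : k + k < N
  k+k<N = subst (k + k <_) (cong (λ m → k + (k + m)) (sym (+-identityʳ k)))
                (+-monoʳ-< k (m<m+n k (>-nonZero⁻¹ k)))

  1+1≤N : 1 + 1 ≤ N
  1+1≤N = ≤-trans (+-mono-≤ (>-nonZero⁻¹ k) (>-nonZero⁻¹ k)) (<⇒≤ k+k<N)

  edgeOf-adjacent : ∀ κ → Adj Δ (proj₁ (edgeOf κ)) (proj₂ (edgeOf κ))
  edgeOf-adjacent (step , x) = here (cdist-⊕ x 1+1≤N)
  edgeOf-adjacent (jump , x) = there (here (cdist-⊕ x (<⇒≤ k+k<N)))
  edgeOf-adjacent (spoke a , x) = tt

  adjacent⇒labelled : ∀ x y → Adj Δ x y → Σ Label λ κ → SameEdge (x , y) (edgeOf κ)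
  adjacent⇒labelled (inj₁ i) (inj₁ j) (here i~j) with cdist≡⇒⊕ i j i~j
  ... | inj₁ refl = (step , i) , inj₁ (refl , refl)
  ... | inj₂ refl = (step , j) , inj₂ (refl , refl)
  adjacent⇒labelled (inj₁ i) (inj₁ j) (there (here i~j)) with cdist≡⇒⊕ i j i~j
  ... | inj₁ refl = (jump , i) , inj₁ (refl , refl)
  ... | inj₂ refl = (jump , j) , inj₂ (refl , refl)
  adjacent⇒labelled (inj₁ i) (inj₂ a) _ = (spoke a , i) , inj₂ (refl , refl)
  adjacent⇒labelled (inj₂ a) (inj₁ i) _ = (spoke a , i) , inj₁ (refl , refl)

  Labelling : List (V × V) → List Label → Set
  Labelling = Pointwise λ e κ → SameEdge e (edgeOf κ)

  labelled⇒adjacent : ∀ {L Ks} → Labelling L Ks → All (λ { (x , y) → Adj Δ x y }) L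
  labelled⇒adjacent [] = []
  labelled⇒adjacent (_∷_ {x , y} {κ} e~κ rest) = adj (SameEdge-sym e~κ) ∷ labelled⇒adjacent rest
    where
    adj : ∀ {x y} → SameEdge (edgeOf κ) (x , y) → Adj Δ x y
    adj (inj₁ (refl , refl)) = edgeOf-adjacent κ
    adj (inj₂ (refl , refl)) = Adj-sym Δ _ _ (edgeOf-adjacent κ)

  module _ (1<k : 1 < k) where

    private
      0<k : 0 < k
      0<k = >-nonZero⁻¹ k

      k<N : k < N
      k<N = <-trans (m<m+n k 0<k) k+k<N

      returns-step : ∀ x y → x ≡ y ⊕ 1 → x ⊕ 1 ≡ y → ⊥
      returns-step x y x≡y⊕1 x⊕1≡y = ⊕-≢ x z<s (≤-<-trans 1<k k<N) (begin
        x ⊕ 2         ≡⟨ sym (⊕-assoc x 1 1) ⟩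
        (x ⊕ 1) ⊕ 1   ≡⟨ cong (_⊕ 1) x⊕1≡y ⟩
        y ⊕ 1         ≡⟨ sym x≡y⊕1 ⟩
        x             ∎)
        where open ≡-Reasoning

      returns-jump : ∀ x y → x ≡ y ⊕ k → x ⊕ k ≡ y → ⊥
      returns-jump x y x≡y⊕k x⊕k≡y = ⊕-≢ x (+-mono-< 0<k 0<k) k+k<N (begin
        x ⊕ (k + k)   ≡⟨ sym (⊕-assoc x k k) ⟩
        (x ⊕ k) ⊕ k   ≡⟨ cong (_⊕ k) x⊕k≡y ⟩
        y ⊕ k         ≡⟨ sym x≡y⊕k ⟩
        x             ∎)
        where open ≡-Reasoning

      step≢jump : ∀ x → x ⊕ 1 ≢ x ⊕ k
      step≢jump x x⊕1≡x⊕k = ⊕-≢ (x ⊕ 1) (m<n⇒0<n∸m 1<k) (≤-<-trans (m∸n≤m k 1) k<N) (begin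
        (x ⊕ 1) ⊕ (k ∸ 1) ≡⟨ ⊕-assoc x 1 (k ∸ 1) ⟩
        x ⊕ (1 + (k ∸ 1)) ≡⟨ cong (x ⊕_) (m+[n∸m]≡n (<⇒≤ 1<k)) ⟩
        x ⊕ k             ≡⟨ sym x⊕1≡x⊕k ⟩
        x ⊕ 1             ∎)
        where open ≡-Reasoning

      jump≢step⁻¹ : ∀ x y → x ≡ y ⊕ k → x ⊕ 1 ≡ y → ⊥
      jump≢step⁻¹ x y x≡y⊕k x⊕1≡y =
        ⊕-≢ y (<-≤-trans 0<k (m≤m+n k 1)) (<-trans (+-monoʳ-< k 1<k) k+k<N) (begin
        y ⊕ (k + 1)   ≡⟨ sym (⊕-assoc y k 1) ⟩
        (y ⊕ k) ⊕ 1   ≡⟨ cong (_⊕ 1) (sym x≡y⊕k) ⟩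
        x ⊕ 1         ≡⟨ x⊕1≡y ⟩
        y             ∎)
        where open ≡-Reasoning

    edgeOf-injective : ∀ {κ κ′} → SameEdge (edgeOf κ) (edgeOf κ′) → κ ≡ κ′
    edgeOf-injective {step , x} {step , y} (inj₁ (refl , _)) = refl
    edgeOf-injective {step , x} {step , y} (inj₂ (x≡y⊕1 , x⊕1≡y)) =
      ⊥-elim (returns-step x y (inj₁-injective x≡y⊕1) (inj₁-injective x⊕1≡y))
    edgeOf-injective {jump , x} {jump , y} (inj₁ (refl , _)) = refl
    edgeOf-injective {jump , x} {jump , y} (inj₂ (x≡y⊕k , x⊕k≡y)) =
      ⊥-elim (returns-jump x y (inj₁-injective x≡y⊕k) (inj₁-injective x⊕k≡y))
    edgeOf-injective {step , x} {jump , y} (inj₁ (refl , x⊕1≡x⊕k)) =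
      ⊥-elim (step≢jump x (inj₁-injective x⊕1≡x⊕k))
    edgeOf-injective {step , x} {jump , y} (inj₂ (x≡y⊕k , x⊕1≡y)) =
      ⊥-elim (jump≢step⁻¹ x y (inj₁-injective x≡y⊕k) (inj₁-injective x⊕1≡y))
    edgeOf-injective {jump , x} {step , y} (inj₁ (refl , x⊕k≡x⊕1)) =
      ⊥-elim (step≢jump x (sym (inj₁-injective x⊕k≡x⊕1)))
    edgeOf-injective {jump , x} {step , y} (inj₂ (x≡y⊕1 , x⊕k≡y)) =
      ⊥-elim (jump≢step⁻¹ y x (sym (inj₁-injective x⊕k≡y)) (sym (inj₁-injective x≡y⊕1)))
    edgeOf-injective {spoke a , x} {spoke b , y} (inj₁ (refl , refl)) = refl
    edgeOf-injective {spoke a , x} {spoke b , y} (inj₂ (() , _))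
    edgeOf-injective {spoke a , x} {step , y} (inj₁ (() , _))
    edgeOf-injective {spoke a , x} {step , y} (inj₂ (() , _))
    edgeOf-injective {spoke a , x} {jump , y} (inj₁ (() , _))
    edgeOf-injective {spoke a , x} {jump , y} (inj₂ (() , _))
    edgeOf-injective {step , x} {spoke b , y} (inj₁ (() , _))
    edgeOf-injective {step , x} {spoke b , y} (inj₂ (_ , ()))
    edgeOf-injective {jump , x} {spoke b , y} (inj₁ (() , _))
    edgeOf-injective {jump , x} {spoke b , y} (inj₂ (_ , ()))


    count≡countᴸ : ∀ {e κ L Ks} → SameEdge e (edgeOf κ) → Labelling L Ks → count e L ≡ countᴸ κ Ks
    count≡countᴸ e~κ [] = refl
    count≡countᴸ {e} {κ} e~κ (_∷_ {p} {κ′} {L} {Ks} p~κ′ rest) with sameEdge? e p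
    ... | yes e~p = begin
      count e (p ∷ L)    ≡⟨ cong length (filter-accept (sameEdge? e) e~p) ⟩
      suc (count e L)    ≡⟨ cong suc (count≡countᴸ e~κ rest) ⟩
      suc (countᴸ κ Ks)  ≡⟨ cong length (filter-accept (_≟ᴸ κ) κ′≡κ) ⟨
      countᴸ κ (κ′ ∷ Ks) ∎
      where
      open ≡-Reasoning
      κ′≡κ : κ′ ≡ κ
      κ′≡κ = edgeOf-injective (SameEdge-trans (SameEdge-sym p~κ′) (SameEdge-trans (SameEdge-sym e~p) e~κ))
    ... | no e≁p = begin
      count e (p ∷ L)    ≡⟨ cong length (filter-reject (sameEdge? e) e≁p) ⟩
      count e L          ≡⟨ count≡countᴸ e~κ rest ⟩
      countᴸ κ Ks        ≡⟨ cong length (filter-reject (_≟ᴸ κ) κ′≢κ) ⟨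
      countᴸ κ (κ′ ∷ Ks) ∎
      where
      open ≡-Reasoning
      κ′≢κ : κ′ ≢ κ
      κ′≢κ refl = e≁p (SameEdge-trans e~κ (SameEdge-sym p~κ′))

    sunDecomposition : ∀ S Ks → Labelling (concatMap sunEdges S) Ks → (∀ κ → countᴸ κ Ks ≡ 1) →
                       IsSunDecomposition Δ S
    sunDecomposition S Ks labelling exact =
        labelled⇒adjacent labelling
      , λ x y x~y → let (κ , xy~κ) = adjacent⇒labelled x y x~y in trans (count≡countᴸ xy~κ labelling) (exact κ)

  rowOf : Fin N → Fin 3
  rowOf = quotient k

  colOf : Fin N → Fin k
  colOf = remainder {3} k

  cellAt : Fin 3 → ℕ → Fin N
  cellAt t r = [ k * toℕ t + r ]

  cellAt-suc : ∀ t r → cellAt t (suc r) ≡ cellAt t r ⊕ 1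
  cellAt-suc t r = trans (cong [_] (trans (+-suc (k * toℕ t) r) (+-comm 1 _))) (sym ([]-⊕ (k * toℕ t + r) 1))

  cellAt-next : ∀ t r → cellAt (next t) r ≡ cellAt t r ⊕ k
  cellAt-next t r = trans (rotate t) (sym ([]-⊕ (k * toℕ t + r) k))
    where
    rotate : ∀ t → cellAt (next t) r ≡ [ k * toℕ t + r + k ]
    rotate 0F = cong [_] (m*[1+n]+o≡m*n+o+m k 0 r)
    rotate 1F = cong [_] (m*[1+n]+o≡m*n+o+m k 1 r)
    rotate 2F = trans (sym ([]-+N (k * 0 + r))) (cong [_] (m*0+n+3*m≡m*2+n+m k r))

  cellAt-k : ∀ t → cellAt t k ≡ cellAt (next t) 0
  cellAt-k t = sym (begin
    cellAt (next t) 0      ≡⟨ cellAt-next t 0 ⟩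
    cellAt t 0 ⊕ k         ≡⟨ []-⊕ (k * toℕ t + 0) k ⟩
    [ k * toℕ t + 0 + k ]  ≡⟨ cong (λ m → [ m + k ]) (+-identityʳ (k * toℕ t)) ⟩
    cellAt t k             ∎)
    where open ≡-Reasoning

  cellAt-combine : ∀ t (j : Fin k) → cellAt t (toℕ j) ≡ combine t j
  cellAt-combine t j = trans (cong [_] (sym (toℕ-combine t j))) ([]-toℕ (combine t j))

  cellAt-coordinates : ∀ x → cellAt (rowOf x) (toℕ (colOf x)) ≡ x
  cellAt-coordinates x = trans (cellAt-combine (rowOf x) (colOf x)) (combine-remQuot {3} k x)

  cellAt-injective : ∀ {t t′ r r′} → r < k → r′ < k → cellAt t r ≡ cellAt t′ r′ → t ≡ t′ × r ≡ r′
  cellAt-injective {t} {t′} {r} {r′} r<k r′<k eq = cong proj₁ same , (begin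
      r               ≡⟨ toℕ-fromℕ< r<k ⟨
      toℕ j           ≡⟨ cong (toℕ ∘ proj₂) same ⟩
      toℕ j′          ≡⟨ toℕ-fromℕ< r′<k ⟩
      r′              ∎)
    where
    open ≡-Reasoning
    j j′ : Fin k
    j = Fin.fromℕ< r<k
    j′ = Fin.fromℕ< r′<k
    same : (t , j) ≡ (t′ , j′)
    same = begin
      (t , j)                          ≡⟨ remQuot-combine t j ⟨
      remQuot k (combine t j)          ≡⟨ cong (remQuot k) (begin
        combine t j                      ≡⟨ cellAt-combine t j ⟨
        cellAt t (toℕ j)                 ≡⟨ cong (cellAt t) (toℕ-fromℕ< r<k) ⟩
        cellAt t r                       ≡⟨ eq ⟩
        cellAt t′ r′                     ≡⟨ cong (cellAt t′) (toℕ-fromℕ< r′<k) ⟨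
        cellAt t′ (toℕ j′)               ≡⟨ cellAt-combine t′ j′ ⟩
        combine t′ j′                    ∎) ⟩
      remQuot k (combine t′ j′)        ≡⟨ remQuot-combine t′ j′ ⟩
      (t′ , j′)                        ∎

  place : ℕ → Point → V
  place o (cell t d) = inj₁ (cellAt t (o + d))
  place o (∞ a)      = inj₂ a

  placeEdge : ℕ → Point × Point → V × V
  placeEdge o (p , q) = place o p , place o q

  placeLabel : ℕ → CellLabel → Label
  placeLabel o (κ , t , d) = κ , cellAt t (o + d)

  place-carries : ∀ o {ε α} → Carries ε α → SameEdge (placeEdge o ε) (edgeOf (placeLabel o α))
  place-carries o (step t d)     = inj₁ (refl , cong inj₁ (trans (cong (cellAt t) (+-suc o d)) (cellAt-suc t (o + d))))
  place-carries o (step⁻ t d)    = inj₂ (cong inj₁ (trans (cong (cellAt t) (+-suc o d)) (cellAt-suc t (o + d))) , refl)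
  place-carries o (jump t d)     = inj₁ (refl , cong inj₁ (cellAt-next t (o + d)))
  place-carries o (jump⁻ t d)    = inj₂ (cong inj₁ (cellAt-next t (o + d)) , refl)
  place-carries o (spoke a t d)  = inj₁ (refl , refl)
  place-carries o (spoke⁻ a t d) = inj₂ (refl , refl)

  module _ {o w : ℕ} (o+w≤k : o + w ≤ k) where

    private
      last-column : ∀ {d} → d ≤ w → o + d ≡ k → d ≡ w
      last-column {d} d≤w o+d≡k = ≤-antisym d≤w (+-cancelˡ-≤ o w d (subst (o + w ≤_) (sym o+d≡k) o+w≤k))

      wrap-around : ∀ {t t′ d d′} → d ≤ w → o + d ≡ k → o + d′ < k →
                    cellAt t (o + d) ≡ cellAt t′ (o + d′) → Wraps w (t , d) (t′ , d′)
      wrap-around {t} {t′} {d} {d′} d≤w o+d≡k o+d′<k eq =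
        last-column d≤w o+d≡k , m+n≡0⇒n≡0 o (sym (proj₂ same)) , sym (proj₁ same)
        where
        same : next t ≡ t′ × 0 ≡ o + d′
        same = cellAt-injective (>-nonZero⁻¹ k) o+d′<k (begin
          cellAt (next t) 0 ≡⟨ cellAt-k t ⟨
          cellAt t k        ≡⟨ cong (cellAt t) o+d≡k ⟨
          cellAt t (o + d)  ≡⟨ eq ⟩
          cellAt t′ (o + d′) ∎)
          where open ≡-Reasoning

    place-apart : ∀ p q → Apart w p q → place o p ≢ place o q
    place-apart (cell t d) (cell t′ d′) (d≤w , d′≤w , distinct , ¬wraps , ¬wraps′) eq
      with m≤n⇒m<n∨m≡n (≤-trans (+-monoʳ-≤ o d≤w) o+w≤k)
         | m≤n⇒m<n∨m≡n (≤-trans (+-monoʳ-≤ o d′≤w) o+w≤k)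
    ... | inj₁ o+d<k | inj₁ o+d′<k =
      let (t≡t′ , o+d≡o+d′) = cellAt-injective o+d<k o+d′<k (inj₁-injective eq)
      in distinct (cong₂ _,_ t≡t′ (+-cancelˡ-≡ o d d′ o+d≡o+d′))
    ... | inj₂ o+d≡k | inj₁ o+d′<k = ¬wraps (wrap-around d≤w o+d≡k o+d′<k (inj₁-injective eq))
    ... | inj₁ o+d<k | inj₂ o+d′≡k = ¬wraps′ (wrap-around d′≤w o+d′≡k o+d<k (sym (inj₁-injective eq)))
    ... | inj₂ o+d≡k | inj₂ o+d′≡k = distinct (cong₂ _,_ t≡t′ (+-cancelˡ-≡ o d d′ (trans o+d≡k (sym o+d′≡k))))
      where
      t≡t′ : t ≡ t′
      t≡t′ = next-injective (proj₁ (cellAt-injective (>-nonZero⁻¹ k) (>-nonZero⁻¹ k) (begin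
        cellAt (next t) 0  ≡⟨ cellAt-k t ⟨
        cellAt t k         ≡⟨ cong (cellAt t) o+d≡k ⟨
        cellAt t (o + d)   ≡⟨ inj₁-injective eq ⟩
        cellAt t′ (o + d′) ≡⟨ cong (cellAt t′) o+d′≡k ⟩
        cellAt t′ k        ≡⟨ cellAt-k t′ ⟩
        cellAt (next t′) 0 ∎)))
        where open ≡-Reasoning
    place-apart (cell _ _) (∞ _) _ ()
    place-apart (∞ _) (cell _ _) _ ()
    place-apart (∞ a) (∞ b) a≢b eq = a≢b (inj₂-injective eq)

    placeSun : (s : Pattern) → AllPairs (Apart w) (points s) → Sun V
    placeSun s apart = record
      { a = place o a ; b = place o b ; c = place o c ; d = place o d ; e = place o e ; f = place o f
      ; distinct = AllPairs.map⁺ (AllPairs.map (λ {p} {q} → place-apart p q) apart)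
      }
      where open Pattern s

    placeSuns : ∀ {P} → All (λ s → AllPairs (Apart w) (points s)) P → List (Sun V)
    placeSuns [] = []
    placeSuns (apart ∷ aparts) = placeSun _ apart ∷ placeSuns aparts

    placeSuns-edges : ∀ {P} (aparts : All (λ s → AllPairs (Apart w) (points s)) P) →
                      concatMap sunEdges (placeSuns aparts) ≡ map (placeEdge o) (concatMap patternEdges P)
    placeSuns-edges [] = refl
    placeSuns-edges {s ∷ P} (_ ∷ aparts) = begin
      map (placeEdge o) (patternEdges s) ++ concatMap sunEdges (placeSuns aparts)
        ≡⟨ cong (map (placeEdge o) (patternEdges s) ++_) (placeSuns-edges aparts) ⟩
      map (placeEdge o) (patternEdges s) ++ map (placeEdge o) (concatMap patternEdges P)
        ≡⟨ map-++ (placeEdge o) (patternEdges s) (concatMap patternEdges P) ⟨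
      map (placeEdge o) (concatMap patternEdges (s ∷ P)) ∎
      where open ≡-Reasoning

    placeLabel-≡ : ∀ {κ′ t d κ x} → d < w → placeLabel o (κ′ , t , d) ≡ (κ , x) →
                   κ′ ≡ κ × t ≡ rowOf x × o + d ≡ toℕ (colOf x)
    placeLabel-≡ {x = x} d<w eq =
      cong proj₁ eq , cellAt-injective (<-≤-trans (+-monoʳ-< o d<w) o+w≤k) (toℕ<n (colOf x))
                        (trans (cong proj₂ eq) (sym (cellAt-coordinates x)))

    module _ (B : Block w) where
      open Block B

      blockSuns : List (Sun V)
      blockSuns = placeSuns separated

      blockLabels : List Label
      blockLabels = map (placeLabel o) labels

      block-labelling : Labelling (concatMap sunEdges blockSuns) blockLabels
      block-labelling = subst (λ L → Labelling L blockLabels) (sym (placeSuns-edges separated))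
        (Pointwise.map⁺ (placeEdge o) (placeLabel o) (Pointwise.map (place-carries o) carries))

      block-inside : ∀ κ x → o ≤ toℕ (colOf x) → toℕ (colOf x) < o + w → countᴸ (κ , x) blockLabels ≡ 1
      block-inside κ x o≤r r<o+w = begin
        countᴸ (κ , x) blockLabels
          ≡⟨ occurrences-map _≟ᶜ_ _≟ᴸ_ (placeLabel o) hit unique in-block ⟩
        occurrences _≟ᶜ_ (κ , rowOf x , r ∸ o) labels
          ≡⟨ cong (λ e → occurrences _≟ᶜ_ (κ , rowOf x , e) labels) (toℕ-fromℕ< d<w) ⟨
        occurrences _≟ᶜ_ (κ , rowOf x , toℕ (Fin.fromℕ< d<w)) labels
          ≡⟨ exact κ (rowOf x) (Fin.fromℕ< d<w) ⟩
        1 ∎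
        where
        open ≡-Reasoning
        r : ℕ
        r = toℕ (colOf x)
        d<w : r ∸ o < w
        d<w = +-cancelˡ-< o (r ∸ o) w (subst (_< o + w) (sym (m+[n∸m]≡n o≤r)) r<o+w)
        hit : placeLabel o (κ , rowOf x , r ∸ o) ≡ (κ , x)
        hit = cong (κ ,_) (trans (cong (cellAt (rowOf x)) (m+[n∸m]≡n o≤r)) (cellAt-coordinates x))
        unique : ∀ {α} → column α < w → placeLabel o α ≡ (κ , x) → α ≡ (κ , rowOf x , r ∸ o)
        unique {κ′ , t , d} d<w′ eq with placeLabel-≡ d<w′ eq
        ... | refl , refl , o+d≡r = cong (λ e → κ , rowOf x , e) (trans (sym (m+n∸m≡n o d)) (cong (_∸ o) o+d≡r))

      block-outside : ∀ κ x → toℕ (colOf x) < o ⊎ o + w ≤ toℕ (colOf x) → countᴸ (κ , x) blockLabels ≡ 0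
      block-outside κ x outside = occurrences-map-∉ _≟ᶜ_ _≟ᴸ_ (placeLabel o) missed in-block
        where
        missed : ∀ {α} → column α < w → placeLabel o α ≢ (κ , x)
        missed {_ , _ , d} d<w eq = [ r<o⇒⊥ , o+w≤r⇒⊥ ]′ outside
          where
          o+d≡r : o + d ≡ toℕ (colOf x)
          o+d≡r = proj₂ (proj₂ (placeLabel-≡ d<w eq))
          r<o⇒⊥ : toℕ (colOf x) < o → ⊥
          r<o⇒⊥ r<o = <⇒≱ r<o (subst (o ≤_) o+d≡r (m≤m+n o d))
          o+w≤r⇒⊥ : o + w ≤ toℕ (colOf x) → ⊥
          o+w≤r⇒⊥ = <⇒≱ (subst (_< o + w) o+d≡r (+-monoʳ-< o d<w))

  private
    head-fits : ∀ o w n → o + (w + n) ≤ k → o + w ≤ k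
    head-fits o w n h = ≤-trans (+-monoʳ-≤ o (m≤m+n w n)) h

    tail-fits : ∀ o w n → o + (w + n) ≤ k → o + w + n ≤ k
    tail-fits o w n h = subst (_≤ k) (sym (+-assoc o w n)) h

  tilingSuns : ∀ o {n} → Tiling n → o + n ≤ k → List (Sun V)
  tilingSuns o [] _ = []
  tilingSuns o (_∷_ {w} {n} B T) h = blockSuns (head-fits o w n h) B ++ tilingSuns (o + w) T (tail-fits o w n h)

  tilingLabels : ∀ o {n} → Tiling n → o + n ≤ k → List Label
  tilingLabels o [] _ = []
  tilingLabels o (_∷_ {w} {n} B T) h = blockLabels (head-fits o w n h) B ++ tilingLabels (o + w) T (tail-fits o w n h)

  tiling-labelling : ∀ o {n} (T : Tiling n) (h : o + n ≤ k) →
                     Labelling (concatMap sunEdges (tilingSuns o T h)) (tilingLabels o T h)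
  tiling-labelling o [] _ = []
  tiling-labelling o (_∷_ {w} {n} B T) h =
    subst (λ L → Labelling L (tilingLabels o (B ∷ T) h))
      (sym (concatMap-++ sunEdges (blockSuns h₁ B) (tilingSuns (o + w) T h₂)))
      (Pointwise.++⁺ (block-labelling h₁ B) (tiling-labelling (o + w) T h₂))
    where
    h₁ : o + w ≤ k
    h₁ = head-fits o w n h
    h₂ : o + w + n ≤ k
    h₂ = tail-fits o w n h

  tiling-outside : ∀ o {n} (T : Tiling n) (h : o + n ≤ k) κ x → toℕ (colOf x) < o ⊎ o + n ≤ toℕ (colOf x) →
                   countᴸ (κ , x) (tilingLabels o T h) ≡ 0
  tiling-outside o [] _ _ _ _ = refl
  tiling-outside o (_∷_ {w} {n} B T) h κ x outside =
    trans (occurrences-++ _≟ᴸ_ (κ , x) (blockLabels h₁ B) (tilingLabels (o + w) T h₂))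
          (cong₂ _+_ (block-outside h₁ B κ x (Sum.map₂ (≤-trans (+-monoʳ-≤ o (m≤m+n w n))) outside))
                     (tiling-outside (o + w) T h₂ κ x (Sum.map (λ r<o → <-≤-trans r<o (m≤m+n o w))
                                                               (≤-trans (≤-reflexive (+-assoc o w n))) outside)))
    where
    h₁ : o + w ≤ k
    h₁ = head-fits o w n h
    h₂ : o + w + n ≤ k
    h₂ = tail-fits o w n h

  tiling-inside : ∀ o {n} (T : Tiling n) (h : o + n ≤ k) κ x → o ≤ toℕ (colOf x) → toℕ (colOf x) < o + n →
                  countᴸ (κ , x) (tilingLabels o T h) ≡ 1
  tiling-inside o [] _ _ x o≤r r<o+0 = ⊥-elim (<⇒≱ r<o+0 (subst (_≤ toℕ (colOf x)) (sym (+-identityʳ o)) o≤r))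
  tiling-inside o (_∷_ {w} {n} B T) h κ x o≤r r<o+w+n =
    trans (occurrences-++ _≟ᴸ_ (κ , x) (blockLabels h₁ B) (tilingLabels (o + w) T h₂)) (split (toℕ (colOf x) <? o + w))
    where
    h₁ : o + w ≤ k
    h₁ = head-fits o w n h
    h₂ : o + w + n ≤ k
    h₂ = tail-fits o w n h
    split : Dec (toℕ (colOf x) < o + w) →
            countᴸ (κ , x) (blockLabels h₁ B) + countᴸ (κ , x) (tilingLabels (o + w) T h₂) ≡ 1
    split (yes r<o+w) = cong₂ _+_ (block-inside h₁ B κ x o≤r r<o+w)
                                  (tiling-outside (o + w) T h₂ κ x (inj₁ r<o+w))
    split (no r≮o+w)  = cong₂ _+_ (block-outside h₁ B κ x (inj₂ (≮⇒≥ r≮o+w)))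
                                  (tiling-inside (o + w) T h₂ κ x (≮⇒≥ r≮o+w)
                                    (subst (toℕ (colOf x) <_) (sym (+-assoc o w n)) r<o+w+n))

  tiled : 1 < k → Tiling k → SunDecomposable N 8 Δ
  tiled 1<k T = suns , sunDecomposition 1<k suns labels (tiling-labelling 0 T ≤-refl) exact
    where
    suns : List (Sun V)
    suns = tilingSuns 0 T ≤-refl
    labels : List Label
    labels = tilingLabels 0 T ≤-refl
    exact : ∀ κ → countᴸ κ labels ≡ 1
    exact (κ , x) = tiling-inside 0 T ≤-refl κ x z≤n (toℕ<n (colOf x))

  -- Junk label on pairs that are not edges; decomposition? checks every edge against it.
  labelOf : V × V → Label
  labelOf (inj₁ x , inj₁ y) with y Fin.≟ x ⊕ 1 | x Fin.≟ y ⊕ 1 | y Fin.≟ x ⊕ k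
  ... | yes _ | _     | _     = step , x
  ... | no _  | yes _ | _     = step , y
  ... | no _  | no _  | yes _ = jump , x
  ... | no _  | no _  | no _  = jump , y
  labelOf (inj₂ a , inj₁ x) = spoke a , x
  labelOf (inj₁ x , inj₂ a) = spoke a , x
  labelOf (inj₂ a , inj₂ _) = spoke a , [ 0 ]

  self-labelling : ∀ {L} → All (λ e → SameEdge e (edgeOf (labelOf e))) L → Labelling L (map labelOf L)
  self-labelling [] = []
  self-labelling (e~κ ∷ rest) = e~κ ∷ self-labelling rest

  realise : Pattern → Maybe (Sun V)
  realise s = do
    distinct ← dec⇒maybe (allPairs? (λ p q → ¬? (p ≟V q)) (map (place 0) (points s)))
    just record { a = place 0 a ; b = place 0 b ; c = place 0 c ; d = place 0 d ; e = place 0 e ; f = place 0 f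
                ; distinct = distinct }
    where open Pattern s

  realiseAll : List Pattern → Maybe (List (Sun V))
  realiseAll [] = just []
  realiseAll (s ∷ P) = do
    S ← realise s
    Ss ← realiseAll P
    just (S ∷ Ss)

  decomposition? : 1 < k → List Pattern → Maybe (SunDecomposable N 8 Δ)
  decomposition? 1<k P = do
    suns ← realiseAll P
    let edges = concatMap sunEdges suns
    labelled ← dec⇒maybe (all? (λ e → sameEdge? e (edgeOf (labelOf e))) edges)
    exact ← dec⇒maybe (∀-kind? λ κ → ∀-fin? λ x → countᴸ (κ , x) (map labelOf edges) ℕ.≟ 1)
    just (suns , sunDecomposition 1<k suns (map labelOf edges) (self-labelling labelled) λ (κ , x) → exact κ x)

block3 : Block 3
block3 = from-just (block? 3 (
  sun (cell 0F 2) (cell 1F 2) (∞ 3F) (∞ 1F) (cell 1F 3) (cell 1F 0) ∷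
  sun (cell 1F 2) (cell 2F 2) (∞ 4F) (∞ 2F) (cell 2F 3) (cell 2F 0) ∷
  sun (cell 2F 2) (cell 0F 2) (∞ 5F) (∞ 0F) (cell 0F 3) (cell 0F 0) ∷
  sun (cell 0F 1) (cell 0F 2) (∞ 0F) (∞ 4F) (∞ 6F) (cell 1F 0) ∷
  sun (cell 1F 1) (cell 1F 2) (∞ 1F) (∞ 5F) (∞ 6F) (cell 2F 0) ∷
  sun (cell 2F 1) (cell 2F 2) (∞ 2F) (∞ 3F) (∞ 6F) (cell 0F 0) ∷
  sun (cell 0F 0) (cell 0F 1) (∞ 7F) (∞ 6F) (∞ 1F) (cell 0F 2) ∷
  sun (cell 1F 0) (cell 1F 1) (∞ 7F) (∞ 6F) (∞ 2F) (cell 1F 2) ∷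
  sun (cell 2F 0) (cell 2F 1) (∞ 7F) (∞ 6F) (∞ 0F) (cell 2F 2) ∷
  sun (cell 0F 0) (cell 1F 0) (∞ 1F) (∞ 3F) (∞ 5F) (cell 2F 2) ∷
  sun (cell 1F 0) (cell 2F 0) (∞ 2F) (∞ 4F) (∞ 3F) (cell 0F 2) ∷
  sun (cell 2F 0) (cell 0F 0) (∞ 0F) (∞ 5F) (∞ 4F) (cell 1F 2) ∷
  sun (cell 0F 1) (cell 1F 1) (∞ 3F) (∞ 2F) (∞ 6F) (cell 2F 2) ∷
  sun (cell 1F 1) (cell 2F 1) (∞ 4F) (∞ 0F) (∞ 6F) (cell 0F 2) ∷
  sun (cell 2F 1) (cell 0F 1) (∞ 5F) (∞ 1F) (∞ 6F) (cell 1F 2) ∷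
  []))

block5 : Block 5
block5 = from-just (block? 5 (
  sun (cell 0F 3) (cell 0F 4) (∞ 4F) (∞ 0F) (cell 0F 5) (cell 1F 1) ∷
  sun (cell 1F 3) (cell 1F 4) (∞ 5F) (∞ 1F) (cell 1F 5) (cell 2F 1) ∷
  sun (cell 2F 3) (cell 2F 4) (∞ 3F) (∞ 2F) (cell 2F 5) (cell 0F 1) ∷
  sun (cell 0F 1) (cell 0F 2) (∞ 6F) (∞ 2F) (∞ 3F) (cell 0F 4) ∷
  sun (cell 1F 1) (cell 1F 2) (∞ 6F) (∞ 0F) (∞ 4F) (cell 1F 4) ∷
  sun (cell 2F 1) (cell 2F 2) (∞ 6F) (∞ 1F) (∞ 5F) (cell 2F 4) ∷
  sun (cell 0F 2) (cell 0F 3) (∞ 7F) (∞ 1F) (∞ 5F) (cell 0F 4) ∷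
  sun (cell 1F 2) (cell 1F 3) (∞ 7F) (∞ 2F) (∞ 3F) (cell 1F 4) ∷
  sun (cell 2F 2) (cell 2F 3) (∞ 7F) (∞ 0F) (∞ 4F) (cell 2F 4) ∷
  sun (cell 0F 3) (cell 1F 3) (∞ 2F) (∞ 3F) (∞ 6F) (cell 2F 4) ∷
  sun (cell 1F 3) (cell 2F 3) (∞ 0F) (∞ 4F) (∞ 6F) (cell 0F 4) ∷
  sun (cell 2F 3) (cell 0F 3) (∞ 1F) (∞ 5F) (∞ 6F) (cell 1F 4) ∷
  sun (cell 0F 2) (cell 1F 2) (∞ 0F) (∞ 4F) (∞ 3F) (cell 1F 0) ∷
  sun (cell 1F 2) (cell 2F 2) (∞ 1F) (∞ 5F) (∞ 4F) (cell 2F 0) ∷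
  sun (cell 2F 2) (cell 0F 2) (∞ 2F) (∞ 3F) (∞ 5F) (cell 0F 0) ∷
  sun (cell 0F 4) (cell 1F 4) (∞ 3F) (∞ 1F) (∞ 0F) (cell 1F 1) ∷
  sun (cell 1F 4) (cell 2F 4) (∞ 4F) (∞ 2F) (∞ 1F) (cell 2F 1) ∷
  sun (cell 2F 4) (cell 0F 4) (∞ 5F) (∞ 0F) (∞ 2F) (cell 0F 1) ∷
  sun (cell 0F 0) (cell 0F 1) (∞ 1F) (∞ 3F) (∞ 7F) (cell 1F 0) ∷
  sun (cell 1F 0) (cell 1F 1) (∞ 2F) (∞ 4F) (∞ 7F) (cell 2F 0) ∷
  sun (cell 2F 0) (cell 2F 1) (∞ 0F) (∞ 5F) (∞ 7F) (cell 0F 0) ∷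
  sun (cell 0F 0) (cell 1F 0) (∞ 5F) (∞ 6F) (∞ 7F) (cell 1F 1) ∷
  sun (cell 1F 0) (cell 2F 0) (∞ 3F) (∞ 6F) (∞ 7F) (cell 2F 1) ∷
  sun (cell 2F 0) (cell 0F 0) (∞ 4F) (∞ 6F) (∞ 7F) (cell 0F 1) ∷
  sun (cell 0F 1) (cell 1F 1) (cell 2F 1) (∞ 0F) (∞ 1F) (∞ 2F) ∷
  []))


decomposition₄ : SunDecomposable 12 8 (1 ∷ 4 ∷ [])
decomposition₄ = from-just (Construction.decomposition? 4 (s≤s (s≤s z≤n)) (
  sun (cell 0F 0) (cell 0F 1) (∞ 0F) (∞ 6F) (∞ 5F) (cell 1F 2) ∷
  sun (cell 1F 0) (cell 1F 1) (∞ 1F) (∞ 6F) (∞ 3F) (cell 2F 2) ∷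
  sun (cell 2F 0) (cell 2F 1) (∞ 2F) (∞ 6F) (∞ 4F) (cell 0F 2) ∷
  sun (cell 0F 2) (cell 0F 3) (∞ 6F) (∞ 3F) (∞ 5F) (cell 0F 1) ∷
  sun (cell 1F 2) (cell 1F 3) (∞ 6F) (∞ 4F) (∞ 3F) (cell 1F 1) ∷
  sun (cell 2F 2) (cell 2F 3) (∞ 6F) (∞ 5F) (∞ 4F) (cell 2F 1) ∷
  sun (cell 0F 1) (cell 1F 1) (cell 2F 1) (∞ 1F) (∞ 2F) (∞ 0F) ∷
  sun (cell 0F 3) (cell 1F 0) (∞ 7F) (∞ 2F) (∞ 5F) (cell 0F 1) ∷
  sun (cell 1F 3) (cell 2F 0) (∞ 7F) (∞ 0F) (∞ 3F) (cell 1F 1) ∷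
  sun (cell 2F 3) (cell 0F 0) (∞ 7F) (∞ 1F) (∞ 4F) (cell 2F 1) ∷
  sun (cell 0F 0) (cell 1F 0) (∞ 2F) (∞ 5F) (∞ 4F) (cell 1F 2) ∷
  sun (cell 1F 0) (cell 2F 0) (∞ 0F) (∞ 3F) (∞ 5F) (cell 2F 2) ∷
  sun (cell 2F 0) (cell 0F 0) (∞ 1F) (∞ 4F) (∞ 3F) (cell 0F 2) ∷
  sun (cell 0F 3) (cell 1F 3) (∞ 1F) (∞ 3F) (∞ 5F) (cell 1F 2) ∷
  sun (cell 1F 3) (cell 2F 3) (∞ 2F) (∞ 4F) (∞ 3F) (cell 2F 2) ∷
  sun (cell 2F 3) (cell 0F 3) (∞ 0F) (∞ 5F) (∞ 4F) (cell 0F 2) ∷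
  sun (cell 0F 1) (cell 0F 2) (∞ 4F) (∞ 2F) (∞ 7F) (cell 1F 1) ∷
  sun (cell 1F 1) (cell 1F 2) (∞ 5F) (∞ 0F) (∞ 7F) (cell 2F 1) ∷
  sun (cell 2F 1) (cell 2F 2) (∞ 3F) (∞ 1F) (∞ 7F) (cell 0F 1) ∷
  sun (cell 0F 2) (cell 1F 2) (cell 2F 2) (∞ 5F) (∞ 3F) (∞ 4F) ∷
  []))

decomposition₇ : SunDecomposable 21 8 (1 ∷ 7 ∷ [])
decomposition₇ = from-just (Construction.decomposition? 7 (s≤s (s≤s z≤n)) (
  sun (cell 0F 0) (cell 1F 0) (∞ 0F) (∞ 7F) (∞ 6F) (cell 0F 1) ∷
  sun (cell 0F 3) (cell 1F 3) (∞ 1F) (∞ 7F) (∞ 0F) (cell 0F 4) ∷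
  sun (cell 0F 6) (cell 1F 6) (∞ 2F) (∞ 7F) (∞ 1F) (cell 1F 0) ∷
  sun (cell 1F 2) (cell 2F 2) (∞ 3F) (∞ 7F) (∞ 2F) (cell 1F 3) ∷
  sun (cell 1F 5) (cell 2F 5) (∞ 4F) (∞ 7F) (∞ 3F) (cell 1F 6) ∷
  sun (cell 2F 1) (cell 0F 1) (∞ 5F) (∞ 7F) (∞ 4F) (cell 2F 2) ∷
  sun (cell 2F 4) (cell 0F 4) (∞ 6F) (∞ 7F) (∞ 5F) (cell 2F 5) ∷
  sun (cell 0F 1) (cell 0F 2) (∞ 1F) (∞ 7F) (∞ 0F) (cell 1F 5) ∷
  sun (cell 0F 4) (cell 0F 5) (∞ 2F) (∞ 7F) (∞ 1F) (cell 2F 1) ∷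
  sun (cell 1F 0) (cell 1F 1) (∞ 3F) (∞ 7F) (∞ 2F) (cell 2F 4) ∷
  sun (cell 1F 3) (cell 1F 4) (∞ 4F) (∞ 7F) (∞ 3F) (cell 0F 0) ∷
  sun (cell 1F 6) (cell 2F 0) (∞ 5F) (∞ 7F) (∞ 4F) (cell 0F 3) ∷
  sun (cell 2F 2) (cell 2F 3) (∞ 6F) (∞ 7F) (∞ 5F) (cell 0F 6) ∷
  sun (cell 2F 5) (cell 2F 6) (∞ 0F) (∞ 7F) (∞ 6F) (cell 1F 2) ∷
  sun (cell 0F 2) (cell 1F 2) (∞ 6F) (∞ 7F) (cell 1F 3) (cell 0F 3) ∷
  sun (cell 0F 5) (cell 1F 5) (∞ 0F) (∞ 7F) (cell 1F 6) (cell 0F 6) ∷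
  sun (cell 1F 1) (cell 2F 1) (∞ 1F) (∞ 7F) (cell 2F 2) (cell 1F 2) ∷
  sun (cell 1F 4) (cell 2F 4) (∞ 2F) (∞ 7F) (cell 2F 5) (cell 1F 5) ∷
  sun (cell 2F 0) (cell 0F 0) (∞ 3F) (∞ 7F) (cell 0F 1) (cell 2F 1) ∷
  sun (cell 2F 3) (cell 0F 3) (∞ 4F) (∞ 7F) (cell 0F 4) (cell 2F 4) ∷
  sun (cell 2F 6) (cell 0F 6) (∞ 5F) (∞ 7F) (cell 1F 0) (cell 0F 0) ∷
  sun (cell 0F 1) (cell 1F 1) (∞ 6F) (∞ 2F) (∞ 5F) (cell 0F 0) ∷
  sun (cell 0F 4) (cell 1F 4) (∞ 0F) (∞ 3F) (∞ 6F) (cell 0F 3) ∷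
  sun (cell 1F 0) (cell 2F 0) (∞ 1F) (∞ 4F) (∞ 0F) (cell 0F 6) ∷
  sun (cell 1F 3) (cell 2F 3) (∞ 2F) (∞ 5F) (∞ 1F) (cell 1F 2) ∷
  sun (cell 1F 6) (cell 2F 6) (∞ 3F) (∞ 6F) (∞ 2F) (cell 1F 5) ∷
  sun (cell 2F 2) (cell 0F 2) (∞ 4F) (∞ 0F) (∞ 3F) (cell 2F 1) ∷
  sun (cell 2F 5) (cell 0F 5) (∞ 5F) (∞ 1F) (∞ 4F) (cell 2F 4) ∷
  sun (cell 0F 2) (cell 0F 3) (∞ 2F) (∞ 5F) (∞ 3F) (cell 2F 5) ∷
  sun (cell 0F 5) (cell 0F 6) (∞ 3F) (∞ 6F) (∞ 4F) (cell 0F 1) ∷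
  sun (cell 1F 1) (cell 1F 2) (∞ 4F) (∞ 0F) (∞ 5F) (cell 0F 4) ∷
  sun (cell 1F 4) (cell 1F 5) (∞ 5F) (∞ 1F) (∞ 6F) (cell 1F 0) ∷
  sun (cell 2F 0) (cell 2F 1) (∞ 6F) (∞ 2F) (∞ 0F) (cell 1F 3) ∷
  sun (cell 2F 3) (cell 2F 4) (∞ 0F) (∞ 3F) (∞ 1F) (cell 1F 6) ∷
  sun (cell 2F 6) (cell 0F 0) (∞ 1F) (∞ 4F) (∞ 2F) (cell 2F 2) ∷
  []))

tiling : ∀ n → Tiling (8 + n)
tiling 0 = block3 ∷ block5 ∷ []
tiling 1 = block3 ∷ block3 ∷ block3 ∷ []
tiling 2 = block5 ∷ block5 ∷ []
tiling (suc (suc (suc n))) = block3 ∷ tiling n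

decomposable : ∀ k → 4 ≤ k → SunDecomposable (3 * k) 8 (1 ∷ k ∷ [])
decomposable 1 (s≤s ())
decomposable 2 (s≤s (s≤s ()))
decomposable 3 (s≤s (s≤s (s≤s ())))
decomposable 4 _ = decomposition₄
decomposable 5 _ = Construction.tiled 5 (s≤s (s≤s z≤n)) (block5 ∷ [])
decomposable 6 _ = Construction.tiled 6 (s≤s (s≤s z≤n)) (block3 ∷ block3 ∷ [])
decomposable 7 _ = decomposition₇
decomposable (suc (suc (suc (suc (suc (suc (suc (suc n)))))))) _ =
  Construction.tiled (8 + n) (s≤s (s≤s z≤n)) (tiling n)

lemma2p4 : (u : ℕ) → 3 ∣ u → 12 ≤ u → SunDecomposable u 8 (1 ∷ u / 3 ∷ [])
lemma2p4 u (divides k refl) 12≤3k =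
  subst₂ (λ u k → SunDecomposable u 8 (1 ∷ k ∷ [])) (*-comm 3 k) (sym (m*n/n≡m k 3))
    (decomposable k (*-cancelʳ-≤ 4 k 3 12≤3k))
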